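{- Let $\varphi\in\mathcal{L}$. Then $\varphi$ is satisfiable relative to the class $\mathbf{QMDM}$ of quasi-multi-decision models if and only if it is satisfiable relative to the class of finite quasi-multi-decision models.
   Context: Let $\mathit{Atm}_0$ be a countable (finite or infinite) set of atomic propositions and $\mathit{Val}$ a finite set of output values; decision atoms $\mathsf{t}(x)$ for $x\in\mathit{Val}$, $\mathit{Dec}=\{\mathsf{t}(x):x\in\mathit{Val}\}$, $\mathit{Atm}=\mathit{Atm}_0\cup\mathit{Dec}$. Language $\mathcal{L}$: $\varphi ::= p \mid \mathsf{t}(x)\mid \neg\varphi\mid \varphi\wedge\varphi\mid \Box_{\mathtt{I}}\varphi\mid \Box_{\mathtt{F}}\varphi$ ($p\in\mathit{Atm}_0$, $x\in\mathit{Val}$). A quasi-multi-decision model (quasi-MDM) is a tuple $M=(W,\sim_{\Box_{\mathtt{I}}},\sim_{\Box_{\mathtt{F}}},V)$ with $W$ a set, $\sim_{\Box_{\mathtt{I}}},\sim_{\Box_{\mathtt{F}}}$ equivalence relations on $W$, $V:W\to2^{\mathit{Atm}}$, writing $V_Y(w)=V(w)\cap Y$, such that for all $w,v\in W$, $x,y\in\mathit{Val}$: (C1) $\sim_{\Box_{\mathtt{I}}}\circ\sim_{\Box_{\mathtt{F}}}=\sim_{\Box_{\mathtt{F}}}\circ\sim_{\Box_{\mathtt{I}}}$; (C3) if $w\sim_{\Box_{\mathtt{F}}}v$ then $V_{\mathit{Atm}_0}(w)=V_{\mathit{Atm}_0}(v)$; (C4) if $\mathsf{t}(x)\in V(w)$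 and $x\neq y$ then $\mathsf{t}(y)\notin V(w)$; (C5) some $\mathsf{t}(x)\in V(w)$. It is finite if $W$ is finite. Truth: atoms $q\in\mathit{Atm}$ true at $w$ iff $q\in V(w)$; Boolean connectives as usual; $\Box_{\mathtt{I}}\varphi$ (resp. $\Box_{\mathtt{F}}\varphi$) true at $w$ iff $\varphi$ true at all $\sim_{\Box_{\mathtt{I}}}$- (resp. $\sim_{\Box_{\mathtt{F}}}$-) related worlds. -}

module Defs where

open import Level using (0ℓ)
open import Data.Nat using (ℕ)
open import Data.Fin using (Fin)
open import Data.Bool using (Bool; true)
open import Data.Sum using (_⊎_; inj₁; inj₂)
open import Data.Product using (Σ; ∃; _×_; _,_)
open import Data.Empty using (⊥)
open import Relation.Nullary using (¬_)
open import Relation.Binary.PropositionalEquality using (_≡_)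
open import Relation.Binary.Structures using (IsEquivalence)
open import Function.Bundles using (_↔_; _⇔_)

module _ (Atm0 Val : Set) where

  -- Atm = Atm0 ∪ Dec, with Dec = { t(x) : x ∈ Val } (a disjoint union).
  Atm : Set
  Atm = Atm0 ⊎ Val

  data Fm : Set where
    atom : Atm0 → Fm
    t    : Val → Fm
    ¬'_  : Fm → Fm
    _∧'_ : Fm → Fm → Fm
    □I   : Fm → Fm
    □F   : Fm → Fm

  _⨾_ : {W : Set} → (W → W → Set) → (W → W → Set) → W → W → Set
  (R ⨾ S) w v = ∃ λ u → R w u × S u v

  -- Quasi-multi-decision models.  V : W → 2^Atm is given as a characteristic
  -- function W → Atm → Bool.
  record QMDM : Set₁ where
    field
      W    : Set
      _∼I_ : W → W → Set
      _∼F_ : W → W → Set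
      V    : W → Atm → Bool
      ∼I-equiv : IsEquivalence _∼I_
      ∼F-equiv : IsEquivalence _∼F_
      C1 : ∀ w v → (_∼I_ ⨾ _∼F_) w v ⇔ (_∼F_ ⨾ _∼I_) w v
      C3 : ∀ w v → w ∼F v → ∀ (p : Atm0) → V w (inj₁ p) ≡ V v (inj₁ p)
      C4 : ∀ w (x y : Val) → V w (inj₂ x) ≡ true → ¬ x ≡ y → ¬ V w (inj₂ y) ≡ true
      C5 : ∀ w → ∃ λ (x : Val) → V w (inj₂ x) ≡ true

  open QMDM

  IsFinite : QMDM → Set
  IsFinite M = Σ ℕ λ m → W M ↔ Fin m

  _,_⊨_ : (M : QMDM) → W M → Fm → Set
  M , w ⊨ atom p   = V M w (inj₁ p) ≡ true
  M , w ⊨ t x      = V M w (inj₂ x) ≡ true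
  M , w ⊨ (¬' φ)   = (M , w ⊨ φ) → ⊥
  M , w ⊨ (φ ∧' ψ) = (M , w ⊨ φ) × (M , w ⊨ ψ)
  M , w ⊨ □I φ     = ∀ v → _∼I_ M w v → M , v ⊨ φ
  M , w ⊨ □F φ     = ∀ v → _∼F_ M w v → M , v ⊨ φ

  SatQMDM : Fm → Set₁
  SatQMDM φ = Σ QMDM λ M → Σ (W M) λ w → M , w ⊨ φ

  SatFinQMDM : Fm → Set₁
  SatFinQMDM φ = Σ QMDM λ M → IsFinite M × Σ (W M) λ w → M , w ⊨ φ

{-# OPTIONS --safe #-}
-- Filtration.  Let φ hold at w.  Restricting to the worlds reachable from w by ∼I
-- followed by ∼F, (C1) makes ∼I ∘ ∼F an equivalence relation with a single class, so any
-- two such worlds are linked both by ∼I ∘ ∼F and by ∼F ∘ ∼I.  Code each such world by the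
-- truth values of ψ, □I ψ and □F ψ for the subformulas ψ of φ, and relate two codes by ∼I
-- (resp. ∼F) when their □I (resp. □F) parts agree.  This is a finite quasi-MDM: (C1)
-- holds because any two codes are linked both ways through a single witness world, and
-- (C3) because for an atom p of φ the □F-part records p.  The usual truth lemma shows
-- that the code of w satisfies φ.
module Submission where

open import Defs
open import Level using (0ℓ)
open import Data.Nat using (ℕ; zero; suc; _+_; _*_; _^_)
open import Data.Fin as Fin using (Fin)
open import Data.Fin.Properties using (2↔Bool; *↔×)
open import Data.Product using (Σ; ∃; _×_; _,_; proj₁; proj₂)
open import Data.Product.Function.NonDependent.Propositional using (_×-↔_)
open import Data.Sum using (inj₁; inj₂)
open import Data.Bool using (Bool; true; false; _∧_)
open import Data.Vec using (Vec; []; _∷_; _++_; map)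
open import Data.Vec.Properties using (map-cong)
open import Data.Vec.Relation.Unary.Any using (here; there)
open import Data.Vec.Relation.Unary.Any.Properties using (++⁻)
open import Data.Vec.Membership.Propositional using (_∈_)
open import Data.Vec.Membership.Propositional.Properties using (∈-++⁺ˡ; ∈-++⁺ʳ)
open import Function.Base using (id; _∘_)
open import Function.Bundles using (_↔_; _⇔_; _↣_; mk↔ₛ′; mk⇔; Equivalence)
open import Function.Properties.Inverse using (↔-trans; ↔-sym)
open import Relation.Nullary using (yes; no; does; contradiction)
open import Relation.Nullary.Decidable using (dec-true; dec-false; does-⇔)
open import Relation.Binary.Structures using (IsEquivalence)
open import Relation.Binary.PropositionalEquality
open import Axiom.ExcludedMiddle using (ExcludedMiddle)

open Equivalence using (to; from)

×-↔-Fin : ∀ {A B : Set} {m n} → A ↔ Fin m → B ↔ Fin n → (A × B) ↔ Fin (m * n)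
×-↔-Fin A↔m B↔n = ↔-trans (A↔m ×-↔ B↔n) (↔-sym *↔×)

Vec-↔-Fin^ : ∀ {A : Set} {m} → A ↔ Fin m → ∀ n → Vec A n ↔ Fin (m ^ n)
Vec-↔-Fin^ A↔m zero =
  mk↔ₛ′ (λ _ → Fin.zero) (λ _ → []) (λ { Fin.zero → refl ; (Fin.suc ()) }) (λ { [] → refl })
Vec-↔-Fin^ {A} A↔m (suc n) = ↔-trans uncons (×-↔-Fin A↔m (Vec-↔-Fin^ A↔m n))
  where
  uncons : Vec A (suc n) ↔ (A × Vec A n)
  uncons = mk↔ₛ′ (λ { (x ∷ xs) → x , xs }) (λ (x , xs) → x ∷ xs)
                 (λ _ → refl) (λ { (x ∷ xs) → refl })

map-≡⇒≡-on-∈ : ∀ {A B : Set} {n} {g h : A → B} {xs : Vec A n} {x} →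
               map g xs ≡ map h xs → x ∈ xs → g x ≡ h x
map-≡⇒≡-on-∈ {xs = _ ∷ _} eq (here refl) = cong (λ { (y ∷ _) → y }) eq
map-≡⇒≡-on-∈ {xs = _ ∷ _} eq (there x∈xs) =
  map-≡⇒≡-on-∈ (cong (λ { (_ ∷ ys) → ys }) eq) x∈xs

-- Relation.Binary.Construct.Composition names this _;_, which user code cannot parse.
infixr 9 _⨟_
_⨟_ : {A : Set} → (A → A → Set) → (A → A → Set) → A → A → Set
(R ⨟ S) x y = ∃ λ k → R x k × S k y

module _ {A : Set} {R S : A → A → Set} (R-equiv : IsEquivalence R) (S-equiv : IsEquivalence S)
         (comm : ∀ {x y} → (S ⨟ R) x y → (R ⨟ S) x y) where
  private
    module R = IsEquivalence R-equiv
    module S = IsEquivalence S-equiv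

  ⨟-isEquivalence : IsEquivalence (R ⨟ S)
  ⨟-isEquivalence = record
    { refl  = _ , R.refl , S.refl
    ; sym   = λ (k , Rxk , Sky) → comm (k , S.sym Sky , R.sym Rxk)
    ; trans = λ (k , Rxk , Sky) (l , Ryl , Slz) →
        let m , Rkm , Sml = comm (_ , Sky , Ryl) in m , R.trans Rxk Rkm , S.trans Sml Slz
    }

∀-related-resp : ∀ {A : Set} {R : A → A → Set} {P : A → Set} → IsEquivalence R →
                 ∀ {u v} → R u v → (∀ x → R u x → P x) → ∀ x → R v x → P x
∀-related-resp R-equiv Ruv all-u x Rvx = all-u x (IsEquivalence.trans R-equiv Ruv Rvx)

module Subformulas (Atm0 Val : Set) where

  size : Fm Atm0 Val → ℕ
  size (atom p) = 0
  size (t x)    = 0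
  size (¬' ψ)   = suc (size ψ)
  size (ψ ∧' χ) = suc (size ψ) + suc (size χ)
  size (□I ψ)   = suc (size ψ)
  size (□F ψ)   = suc (size ψ)

  subformulas : (φ : Fm Atm0 Val) → Vec (Fm Atm0 Val) (suc (size φ))
  properSubformulas : (φ : Fm Atm0 Val) → Vec (Fm Atm0 Val) (size φ)

  subformulas φ = φ ∷ properSubformulas φ

  properSubformulas (atom p) = []
  properSubformulas (t x)    = []
  properSubformulas (¬' ψ)   = subformulas ψ
  properSubformulas (ψ ∧' χ) = subformulas ψ ++ subformulas χ
  properSubformulas (□I ψ)   = subformulas ψ
  properSubformulas (□F ψ)   = subformulas ψ

  infix 4 _⊑_
  _⊑_ : Fm Atm0 Val → Fm Atm0 Val → Set
  ψ ⊑ φ = ψ ∈ subformulas φ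

  ⊑-trans : ∀ {ψ χ φ} → ψ ⊑ χ → χ ⊑ φ → ψ ⊑ φ
  ⊑-trans             ψ⊑χ (here refl) = ψ⊑χ
  ⊑-trans {φ = ¬' _}  ψ⊑χ (there χ⊑φ) = there (⊑-trans ψ⊑χ χ⊑φ)
  ⊑-trans {φ = □I _}  ψ⊑χ (there χ⊑φ) = there (⊑-trans ψ⊑χ χ⊑φ)
  ⊑-trans {φ = □F _}  ψ⊑χ (there χ⊑φ) = there (⊑-trans ψ⊑χ χ⊑φ)
  ⊑-trans {φ = φ₁ ∧' φ₂} ψ⊑χ (there χ⊑φ) with ++⁻ (subformulas φ₁) χ⊑φ
  ... | inj₁ χ⊑φ₁ = there (∈-++⁺ˡ (⊑-trans ψ⊑χ χ⊑φ₁))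
  ... | inj₂ χ⊑φ₂ = there (∈-++⁺ʳ (subformulas φ₁) (⊑-trans ψ⊑χ χ⊑φ₂))

  ⊑-¬ : ∀ {ψ} → ψ ⊑ ¬' ψ
  ⊑-¬ = there (here refl)

  ⊑-∧ˡ : ∀ {ψ χ} → ψ ⊑ ψ ∧' χ
  ⊑-∧ˡ {ψ} {χ} = there (∈-++⁺ˡ {xs = subformulas ψ} {ys = subformulas χ} (here refl))

  ⊑-∧ʳ : ∀ {ψ χ} → χ ⊑ ψ ∧' χ
  ⊑-∧ʳ {ψ} = there (∈-++⁺ʳ (subformulas ψ) (here refl))

  ⊑-□I : ∀ {ψ} → ψ ⊑ □I ψ
  ⊑-□I = there (here refl)

  ⊑-□F : ∀ {ψ} → ψ ⊑ □F ψ
  ⊑-□F = there (here refl)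

module Classical (em : ExcludedMiddle 0ℓ) where

  ⌊_⌋ : Set → Bool
  ⌊ P ⌋ = does (em {P})

  ⌊⌋-true : ∀ {P} → P → ⌊ P ⌋ ≡ true
  ⌊⌋-true = dec-true em

  ⌊⌋-true⁻¹ : ∀ {P} → ⌊ P ⌋ ≡ true → P
  ⌊⌋-true⁻¹ {P} eq with em {P}
  ... | yes p = p
  ⌊⌋-true⁻¹ () | no _

  ⌊⌋-cong : ∀ {P Q} → P ⇔ Q → ⌊ P ⌋ ≡ ⌊ Q ⌋
  ⌊⌋-cong P⇔Q = does-⇔ P⇔Q em em

  ⌊⌋-transport : ∀ {P Q} → ⌊ P ⌋ ≡ ⌊ Q ⌋ → P → Q
  ⌊⌋-transport eq p = ⌊⌋-true⁻¹ (trans (sym eq) (⌊⌋-true p))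

  ⌊≡true⌋ : ∀ b → ⌊ b ≡ true ⌋ ≡ b
  ⌊≡true⌋ true  = ⌊⌋-true refl
  ⌊≡true⌋ false = dec-false em (λ ())

  module _ {A C : Set} (P : A → Set) {a₀ : A} (Pa₀ : P a₀) (g : A → C) where

    section : C → A
    section c with em {Σ A λ a → P a × g a ≡ c}
    ... | yes (a , _) = a
    ... | no _        = a₀

    section-∈ : ∀ c → P (section c)
    section-∈ c with em {Σ A λ a → P a × g a ≡ c}
    ... | yes (_ , Pa , _) = Pa
    ... | no _             = Pa₀

    section-inverse : ∀ {a} → P a → g (section (g a)) ≡ g a
    section-inverse {a} Pa with em {Σ A λ b → P b × g b ≡ g a}
    ... | yes (_ , _ , eq) = eq
    ... | no ∄b            = contradiction (a , Pa , refl) ∄b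

module FiniteModelProperty (em : ExcludedMiddle 0ℓ) (Atm0 Val : Set) where
  open QMDM
  open Subformulas Atm0 Val
  open Classical em

  Formula : Set
  Formula = Fm Atm0 Val

  Model : Set₁
  Model = QMDM Atm0 Val

  infix 4 _,_⊩_
  _,_⊩_ : (M : Model) → W M → Formula → Set
  M , u ⊩ φ = _,_⊨_ Atm0 Val M u φ

  □F-atom⇔atom : ∀ M {u p} → (M , u ⊩ □F (atom p)) ⇔ (M , u ⊩ atom p)
  □F-atom⇔atom M {u} {p} = mk⇔
    (λ h → h u (IsEquivalence.refl (∼F-equiv M)))
    (λ h v u∼v → trans (sym (C3 M u v u∼v p)) h)

  module Filtration (M : Model) (w : W M) (φ : Formula) where
    private
      module EI = IsEquivalence (∼I-equiv M)
      module EF = IsEquivalence (∼F-equiv M)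
      _∼I'_ _∼F'_ : W M → W M → Set
      _∼I'_ = _∼I_ M
      _∼F'_ = _∼F_ M

    ∼I⨟∼F-isEquivalence : IsEquivalence (_∼I'_ ⨟ _∼F'_)
    ∼I⨟∼F-isEquivalence = ⨟-isEquivalence (∼I-equiv M) (∼F-equiv M) (from (C1 M _ _))

    private
      module E = IsEquivalence ∼I⨟∼F-isEquivalence

    Reachable : W M → Set
    Reachable = (_∼I'_ ⨟ _∼F'_) w

    reachable-∼I : ∀ {u v} → Reachable u → u ∼I' v → Reachable v
    reachable-∼I wu u∼v = E.trans wu (_ , u∼v , EF.refl)

    reachable-∼F : ∀ {u v} → Reachable u → u ∼F' v → Reachable v
    reachable-∼F wu u∼v = E.trans wu (_ , EI.refl , u∼v)

    n : ℕ
    n = suc (size φ)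

    profile : (Formula → Formula) → W M → Vec Bool n
    profile g u = map (λ ψ → ⌊ M , u ⊩ g ψ ⌋) (subformulas φ)

    profile-transport : ∀ {g u v ψ} → profile g u ≡ profile g v → ψ ⊑ φ →
                        M , u ⊩ g ψ → M , v ⊩ g ψ
    profile-transport eq ψ⊑φ = ⌊⌋-transport (map-≡⇒≡-on-∈ eq ψ⊑φ)

    profile-□I : ∀ {u v} → u ∼I' v → profile □I u ≡ profile □I v
    profile-□I u∼v = map-cong (λ _ → ⌊⌋-cong (mk⇔
      (∀-related-resp (∼I-equiv M) u∼v) (∀-related-resp (∼I-equiv M) (EI.sym u∼v)))) _

    profile-□F : ∀ {u v} → u ∼F' v → profile □F u ≡ profile □F v
    profile-□F u∼v = map-cong (λ _ → ⌊⌋-cong (mk⇔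
      (∀-related-resp (∼F-equiv M) u∼v) (∀-related-resp (∼F-equiv M) (EF.sym u∼v)))) _

    Code : Set
    Code = Vec Bool n × Vec Bool n × Vec Bool n

    code : W M → Code
    code u = profile id u , profile □I u , profile □F u

    rep : Code → W M
    rep = section Reachable E.refl code

    rep-reachable : ∀ c → Reachable (rep c)
    rep-reachable = section-∈ Reachable E.refl code

    code-rep : ∀ {u} → Reachable u → code (rep (code u)) ≡ code u
    code-rep = section-inverse Reachable E.refl code

    rep-profile-id : ∀ {u} → Reachable u → profile id (rep (code u)) ≡ profile id u
    rep-profile-id wu = cong proj₁ (code-rep wu)

    rep-profile-□I : ∀ {u} → Reachable u → profile □I (rep (code u)) ≡ profile □I u
    rep-profile-□I wu = cong (proj₁ ∘ proj₂) (code-rep wu)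

    rep-profile-□F : ∀ {u} → Reachable u → profile □F (rep (code u)) ≡ profile □F u
    rep-profile-□F wu = cong (proj₂ ∘ proj₂) (code-rep wu)

    rep-code-⊩ : ∀ {u ψ} → Reachable u → ψ ⊑ φ → M , rep (code u) ⊩ ψ ⇔ M , u ⊩ ψ
    rep-code-⊩ wu ψ⊑φ = mk⇔ (profile-transport (rep-profile-id wu) ψ⊑φ)
                            (profile-transport (sym (rep-profile-id wu)) ψ⊑φ)

    _≈I_ _≈F_ : Code → Code → Set
    c ≈I d = profile □I (rep c) ≡ profile □I (rep d)
    c ≈F d = profile □F (rep c) ≡ profile □F (rep d)

    -- Atoms outside φ are made false: for them nothing forces (C3) in the filtration.
    valuation : Code → Atm Atm0 Val → Bool
    valuation c (inj₁ p) = ⌊ atom p ⊑ φ ⌋ ∧ V M (rep c) (inj₁ p)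
    valuation c (inj₂ x) = V M (rep c) (inj₂ x)

    valuation-C3 : ∀ c d → c ≈F d → ∀ p → valuation c (inj₁ p) ≡ valuation d (inj₁ p)
    valuation-C3 c d c≈d p with em {atom p ⊑ φ}
    ... | no _     = refl
    ... | yes p⊑φ  = begin
      V M (rep c) (inj₁ p)           ≡⟨ ⌊≡true⌋ _ ⟨
      ⌊ M , rep c ⊩ atom p ⌋         ≡⟨ ⌊⌋-cong (□F-atom⇔atom M) ⟨
      ⌊ M , rep c ⊩ □F (atom p) ⌋    ≡⟨ map-≡⇒≡-on-∈ c≈d p⊑φ ⟩
      ⌊ M , rep d ⊩ □F (atom p) ⌋    ≡⟨ ⌊⌋-cong (□F-atom⇔atom M) ⟩
      ⌊ M , rep d ⊩ atom p ⌋         ≡⟨ ⌊≡true⌋ _ ⟩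
      V M (rep d) (inj₁ p)           ∎
      where open ≡-Reasoning

    ≈I⨟≈F-total : ∀ c d → (_≈I_ ⨟ _≈F_) c d
    ≈I⨟≈F-total c d =
      let x , c∼x , x∼d = E.trans (E.sym (rep-reachable c)) (rep-reachable d)
          wx = reachable-∼I (rep-reachable c) c∼x
      in code x , trans (profile-□I c∼x) (sym (rep-profile-□I wx))
                , trans (rep-profile-□F wx) (profile-□F x∼d)

    ≈F⨟≈I-total : ∀ c d → (_≈F_ ⨟ _≈I_) c d
    ≈F⨟≈I-total c d =
      let x , c∼x , x∼d = to (C1 M _ _) (E.trans (E.sym (rep-reachable c)) (rep-reachable d))
          wx = reachable-∼F (rep-reachable c) c∼x
      in code x , trans (profile-□F c∼x) (sym (rep-profile-□F wx))
                , trans (rep-profile-□I wx) (profile-□I x∼d)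

    filtration : Model
    filtration = record
      { W        = Code
      ; _∼I_     = _≈I_
      ; _∼F_     = _≈F_
      ; V        = valuation
      ; ∼I-equiv = record { refl = refl ; sym = sym ; trans = trans }
      ; ∼F-equiv = record { refl = refl ; sym = sym ; trans = trans }
      ; C1       = λ c d → mk⇔ (λ _ → ≈F⨟≈I-total c d) (λ _ → ≈I⨟≈F-total c d)
      ; C3       = valuation-C3
      ; C4       = λ c → C4 M (rep c)
      ; C5       = λ c → C5 M (rep c)
      }

    filtration-finite : IsFinite Atm0 Val filtration
    filtration-finite = _ , ×-↔-Fin profiles↔ (×-↔-Fin profiles↔ profiles↔)
      where
      profiles↔ : Vec Bool n ↔ Fin (2 ^ n)
      profiles↔ = Vec-↔-Fin^ (↔-sym 2↔Bool) n

    truth : ∀ ψ → ψ ⊑ φ → ∀ c → filtration , c ⊩ ψ ⇔ M , rep c ⊩ ψ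
    truth (atom p) p⊑φ c rewrite ⌊⌋-true p⊑φ = mk⇔ id id
    truth (t x)    _   c = mk⇔ id id
    truth (¬' ψ)   ¬ψ⊑φ c =
      let ih = truth ψ (⊑-trans ⊑-¬ ¬ψ⊑φ) c in mk⇔ (λ h → h ∘ from ih) (λ h → h ∘ to ih)
    truth (ψ ∧' χ) ψ∧χ⊑φ c =
      let ihψ = truth ψ (⊑-trans ⊑-∧ˡ ψ∧χ⊑φ) c
          ihχ = truth χ (⊑-trans ⊑-∧ʳ ψ∧χ⊑φ) c
      in mk⇔ (λ (a , b) → to ihψ a , to ihχ b) (λ (a , b) → from ihψ a , from ihχ b)
    truth (□I ψ) □Iψ⊑φ c = mk⇔ ⇒ ⇐
      where
      ψ⊑φ : ψ ⊑ φ
      ψ⊑φ = ⊑-trans ⊑-□I □Iψ⊑φ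
      ⇒ : filtration , c ⊩ □I ψ → M , rep c ⊩ □I ψ
      ⇒ h v c∼v = to (rep-code-⊩ wv ψ⊑φ) (to (truth ψ ψ⊑φ (code v))
                    (h (code v) (trans (profile-□I c∼v) (sym (rep-profile-□I wv)))))
        where
        wv : Reachable v
        wv = reachable-∼I (rep-reachable c) c∼v
      ⇐ : M , rep c ⊩ □I ψ → filtration , c ⊩ □I ψ
      ⇐ h d c≈d = from (truth ψ ψ⊑φ d) (profile-transport {g = □I} c≈d ψ⊑φ h (rep d) EI.refl)
    truth (□F ψ) □Fψ⊑φ c = mk⇔ ⇒ ⇐
      where
      ψ⊑φ : ψ ⊑ φ
      ψ⊑φ = ⊑-trans ⊑-□F □Fψ⊑φ
      ⇒ : filtration , c ⊩ □F ψ → M , rep c ⊩ □F ψ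
      ⇒ h v c∼v = to (rep-code-⊩ wv ψ⊑φ) (to (truth ψ ψ⊑φ (code v))
                    (h (code v) (trans (profile-□F c∼v) (sym (rep-profile-□F wv)))))
        where
        wv : Reachable v
        wv = reachable-∼F (rep-reachable c) c∼v
      ⇐ : M , rep c ⊩ □F ψ → filtration , c ⊩ □F ψ
      ⇐ h d c≈d = from (truth ψ ψ⊑φ d) (profile-transport {g = □F} c≈d ψ⊑φ h (rep d) EF.refl)

    satisfiable-in-finite : M , w ⊩ φ → SatFinQMDM Atm0 Val φ
    satisfiable-in-finite w⊩φ =
      filtration , filtration-finite , code w ,
      from (truth φ (here refl) (code w)) (from (rep-code-⊩ E.refl (here refl)) w⊩φ)

theorem4 : ExcludedMiddle 0ℓ →
           (Atm0 Val : Set) → Atm0 ↣ ℕ → Σ ℕ (λ n → Val ↔ Fin n) →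
           (φ : Fm Atm0 Val) → SatQMDM Atm0 Val φ ⇔ SatFinQMDM Atm0 Val φ
theorem4 em Atm0 Val _ _ φ = mk⇔
  (λ (M , w , w⊨φ) → Filtration.satisfiable-in-finite M w φ w⊨φ)
  (λ (M , _ , w⊨φ) → M , w⊨φ)
  where open FiniteModelProperty em Atm0 Val
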